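{- Let $G=(A,B,E)$ be a bipartite graph that is not a matching. If $e(P_{G,A})=1$ and $\mathrm{La}(n,P_{G,A})=(1+o(1))\binom{n}{\lfloor n/2\rfloor}$ as $n\to\infty$, then $\mathrm{vex}(n,G)=2^{n-1}+(1/2+o(1))\binom{n}{\lfloor n/2\rfloor}$.
   Context: The Kneser cube $Kn_n$ is the graph with vertex set $2^{[n]}$ (all subsets of $[n]=\{1,\dots,n\}$) in which two distinct vertices are adjacent iff they are disjoint. $\mathrm{vex}(n,G)$ is the maximum size of $\mathcal{F}\subseteq 2^{[n]}$ such that the induced subgraph $Kn_n[\mathcal{F}]$ contains no subgraph isomorphic to $G$. For a bipartite graph $G=(A,B,E)$, $P_{G,A}$ is the poset on $V(G)$ whose Hasse diagram is $G$ with each edge oriented towards its endpoint in $A$ (relations $b\prec a$ for $ab\in E$, $a\in A$, $b\in B$). A family $\mathcal{G}\subseteq 2^{[n]}$ is a copy of a poset $(P,\prec)$ if there is a bijection $\beta:P\to\mathcal{G}$ with $p\prec q\Rightarrow\beta(p)\subseteq\beta(q)$; a family is $P$-free if it contains no copy of $P$. $\mathrm{La}(n,P)$ is the maximum size of a $P$-free family $\mathcal{F}\subseteq 2^{[n]}$. $e(P)$ is the largest integer $k$ such that for every $n$ and $j<n$ the family $\bigcup_{i=1}^k\binom{[n]}{j+i}$ is $P$-free, where $\binom{[n]}{m}$ is the family of $m$-subsets of $[n]$. -}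

module Defs where

open import Data.Nat using (ℕ; zero; suc; _+_; _*_; _^_; _≤_; _<_; _≥_; _/_)
open import Data.Nat.Combinatorics using (_C_)
open import Data.Fin using (Fin)
open import Data.Fin.Subset using (Subset; _⊆_; _∩_; ∣_∣; ⊥)
open import Data.Bool using (Bool; true)
open import Data.Sum using (_⊎_; inj₁; inj₂)
open import Data.Product using (Σ; _×_; _,_; ∃; ∃-syntax)
open import Data.List using (List; length)
open import Data.List.Membership.Propositional using (_∈_)
open import Data.List.Relation.Unary.Unique.Propositional using (Unique)
open import Relation.Binary.PropositionalEquality using (_≡_; _≢_)
open import Relation.Nullary using (¬_)
open import Function.Definitions using (Injective)

record BipGraph : Set where
  field
    a : ℕ
    b : ℕ
    E : Fin a → Fin b → Bool

open BipGraph public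

V : BipGraph → Set
V G = Fin (a G) ⊎ Fin (b G)

IsMatching : BipGraph → Set
IsMatching G =
  (∀ (i : Fin (a G)) (j j′ : Fin (b G)) → E G i j ≡ true → E G i j′ ≡ true → j ≡ j′) ×
  (∀ (i i′ : Fin (a G)) (j : Fin (b G)) → E G i j ≡ true → E G i′ j ≡ true → i ≡ i′)

Family : ℕ → Set₁
Family n = Subset n → Set

Disjoint : ∀ {n} → Subset n → Subset n → Set
Disjoint s t = s ∩ t ≡ ⊥

-- Kn_n[F] contains a (not necessarily induced) subgraph isomorphic to G:
-- an injective map V(G) → F sending edges to disjoint pairs.
ContainsG : (G : BipGraph) → ∀ {n} → Family n → Set
ContainsG G {n} F =
  Σ (V G → Subset n) λ f →
    Injective _≡_ _≡_ f ×
    (∀ v → F (f v)) ×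
    (∀ i j → E G i j ≡ true → Disjoint (f (inj₁ i)) (f (inj₂ j)))

-- F contains a copy of the poset P_{G,A}: an injective map β : V(G) → F with
-- β(b) ⊆ β(a) whenever ab ∈ E (these generate all relations b ≺ a of P_{G,A}).
ContainsPGA : (G : BipGraph) → ∀ {n} → Family n → Set
ContainsPGA G {n} F =
  Σ (V G → Subset n) λ β →
    Injective _≡_ _≡_ β ×
    (∀ v → F (β v)) ×
    (∀ i j → E G i j ≡ true → β (inj₂ j) ⊆ β (inj₁ i))

PGA-free : (G : BipGraph) → ∀ {n} → Family n → Set
PGA-free G F = ¬ ContainsPGA G F

G-free : (G : BipGraph) → ∀ {n} → Family n → Set
G-free G F = ¬ ContainsG G F

-- m is the maximum size of a family F ⊆ 2^[n] (a duplicate-free list of subsets)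
-- satisfying the property Good.
IsMaxSize : (n : ℕ) → (Family n → Set) → ℕ → Set
IsMaxSize n Good m =
  (∀ (L : List (Subset n)) → Unique L → Good (λ s → s ∈ L) → length L ≤ m) ×
  (Σ (List (Subset n)) λ L → Unique L × Good (λ s → s ∈ L) × length L ≡ m)

IsLa : BipGraph → ℕ → ℕ → Set
IsLa G n m = IsMaxSize n (PGA-free G) m

IsVex : BipGraph → ℕ → ℕ → Set
IsVex G n m = IsMaxSize n (G-free G) m

Levels : (n j k : ℕ) → Family n
Levels n j k S = Σ ℕ λ i → (1 ≤ i) × (i ≤ k) × (∣ S ∣ ≡ j + i)

EGood : BipGraph → ℕ → Set
EGood G k = ∀ (n j : ℕ) → j < n → PGA-free G (Levels n j k)

IsE : BipGraph → ℕ → Set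
IsE G k = EGood G k × (∀ k′ → EGood G k′ → k′ ≤ k)

centralBinom : ℕ → ℕ
centralBinom n = n C (n / 2)

-- f(n) = (1 + o(1)) binom(n,⌊n/2⌋):  for every k ≥ 1, eventually
-- k · |f(n) − C(n)| ≤ C(n).
AsympCentral : (ℕ → ℕ) → Set
AsympCentral f = ∀ (k : ℕ) → 1 ≤ k → ∃[ N ] ∀ n → N ≤ n →
  (k * f n ≤ k * centralBinom n + centralBinom n) ×
  (k * centralBinom n ≤ k * f n + centralBinom n)

-- f(n) = 2^{n-1} + (1/2 + o(1)) binom(n,⌊n/2⌋): for every k ≥ 1, eventually
-- k · |2 f(n) − 2^n − C(n)| ≤ 2 C(n)   (i.e. |f(n) − 2^{n-1} − C(n)/2| ≤ C(n)/k).
AsympVex : (ℕ → ℕ) → Set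
AsympVex f = ∀ (k : ℕ) → 1 ≤ k → ∃[ N ] ∀ n → N ≤ n →
  (k * (2 * f n) ≤ k * (2 ^ n + centralBinom n) + 2 * centralBinom n) ×
  (k * (2 ^ n + centralBinom n) ≤ k * (2 * f n) + 2 * centralBinom n)

{-# OPTIONS --safe #-}

-- Split 2^[n+1] according to the first point, and record a set avoiding it by its complement
-- in the other n points. For a G-free family F, let X be the sets s with s ∪ {first} ∈ F and Y
-- the sets s whose complement lies in F; then |F| = |X| + |Y| = |X ∪ Y| + |X ∩ Y| ≤ 2^n + |X ∩ Y|,
-- and X ∩ Y is P_{G,A}-free: a copy β of the poset there yields the copy a ↦ ∁ β(a),
-- b ↦ β(b) ∪ {first} of G in F, as b ≺ a makes the two disjoint. Hence vex(n+1, G) ≤ 2^n + La(n).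
-- Conversely, take all S ⊆ [n+1] with 2|S| > n and all S through the first point with 2|S| ≥ n.
-- Two disjoint members are complementary, so a copy of G there would make G a matching; and the
-- family has at least 2^n + C(n, t) members, t being the level just below the middle of [n].
-- Both bounds are 2^n + (1/2 + o(1)) C(n+1, ⌊(n+1)/2⌋): this coefficient is C(n, t) + C(n, ⌊n/2⌋),
-- and by the absorption identity C(n, ⌊n/2⌋) − C(n, t) ≤ C(n, ⌊n/2⌋)/(t+1).

module Submission where

open import Defs
import Algebra.Lattice.Properties.BooleanAlgebra as BooleanAlgebraProperties
open import Data.Bool using (true; false) renaming (_≟_ to _≟ᵇ_)
open import Data.Fin using (Fin; zero; suc)
open import Data.Fin.Properties using (injective⇒≤)
open import Data.Fin.Subset as Subset using (Subset; inside; outside; ∁; ∣_∣; _⊆_)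
open import Data.Fin.Subset.Properties as Subsetₚ
  using (∪-∩-booleanAlgebra; ∣∁p∣≡n∸∣p∣; ∣p∣≤n; p⊆q⇒∣p∣≤∣q∣; p⊂q⇒∣p∣<∣q∣; x∈p∩q⁺; x∈p∩q⁻;
         x∈∁p⇒x∉p; x∉p⇒x∈∁p; ∉⊥; Empty-unique; ⊆-antisym; ∩-comm)
open import Data.List using (List; _∷_; []; [_]; _++_; length; lookup; filter; map)
open import Data.List.Properties
  using (length-++; length-map; length-filter; filter-++; filter-all; filter-none; filter-≐)
open import Data.List.Membership.Propositional using (_∈_)
open import Data.List.Membership.Propositional.Properties
  using (∈-lookup; ∈-map⁺; ∈-map⁻; ∈-++⁺ˡ; ∈-++⁺ʳ; ∈-++⁻; ∈-filter⁺; ∈-filter⁻)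
import Data.List.Membership.DecPropositional as DecMembership
open import Data.List.Relation.Binary.Sublist.Propositional using (⊆-refl)
open import Data.List.Relation.Binary.Sublist.Propositional.Properties using (length-mono-≤; filter⁺)
open import Data.List.Relation.Unary.All as All using ()
open import Data.List.Relation.Unary.Any as Any using (here)
open import Data.List.Relation.Unary.Any.Properties using (lookup-index)
open import Data.List.Relation.Unary.Unique.Propositional using (Unique)
import Data.List.Relation.Unary.Unique.Propositional.Properties as Unique
open import Data.Nat using (ℕ; zero; suc; s≤s; z≤n; _+_; _*_; _^_; _/_; _≤_; _<_; _≟_; _≤?_; _<?_)
open import Data.Nat.Combinatorics using (_C_; nC1≡n; nCk+nC[k+1]≡[n+1]C[k+1])
open import Data.Nat.DivMod using (m*n/n≡m; m/n≡1+[m∸n]/n)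
open import Data.Nat.Properties
open import Data.Nat.Tactic.RingSolver using (solve)
open import Data.Product using (∃-syntax; _×_; _,_; proj₁; proj₂)
open import Data.Sum using (_⊎_; inj₁; inj₂)
open import Data.Sum.Properties using (inj₁-injective; inj₂-injective)
import Data.Vec.Properties as Vec
open import Function using (_∘_)
open import Function.Definitions using (Injective)
open import Relation.Nullary using (¬_; yes; no; does; contradiction)
open import Relation.Unary using (Pred; Decidable)
open import Relation.Unary.Properties using (_∪?_; _∩?_)
open import Relation.Binary.PropositionalEquality
  using (_≡_; refl; sym; trans; subst; cong; cong₂; module ≡-Reasoning)

absorption : ∀ n k → suc k * (suc n C suc k) ≡ suc n * (n C k)
absorption zero zero = refl
absorption zero (suc k) = *-zeroʳ (suc (suc k))
absorption (suc n) zero = trans (+-identityʳ _) (trans (nC1≡n (suc (suc n))) (sym (*-identityʳ _)))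
absorption (suc n) (suc k) = begin
  suc (suc k) * (suc (suc n) C suc (suc k))
    ≡⟨ cong (suc (suc k) *_) (nCk+nC[k+1]≡[n+1]C[k+1] (suc n) (suc k)) ⟨
  suc (suc k) * (c₁ + c₂)
    ≡⟨ *-distribˡ-+ (suc (suc k)) c₁ c₂ ⟩
  (c₁ + suc k * c₁) + suc (suc k) * c₂
    ≡⟨ +-assoc c₁ (suc k * c₁) (suc (suc k) * c₂) ⟩
  c₁ + (suc k * c₁ + suc (suc k) * c₂)
    ≡⟨ cong₂ (λ x y → c₁ + (x + y)) (absorption n k) (absorption n (suc k)) ⟩
  c₁ + (suc n * (n C k) + suc n * (n C suc k))
    ≡⟨ cong (c₁ +_) (*-distribˡ-+ (suc n) (n C k) (n C suc k)) ⟨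
  c₁ + suc n * (n C k + n C suc k)
    ≡⟨ cong (λ x → c₁ + suc n * x) (nCk+nC[k+1]≡[n+1]C[k+1] n k) ⟩
  suc (suc n) * (suc n C suc k) ∎
  where
  open ≡-Reasoning
  c₁ c₂ : ℕ
  c₁ = suc n C suc k
  c₂ = suc n C suc (suc k)

ratio-bound : ∀ m {a c} k → m * c ≡ suc m * a → k ≤ suc m → k * c ≤ k * a + c
ratio-bound m {a} {c} k mc≡[1+m]a k≤1+m = *-cancelˡ-≤ (suc m) (begin
  suc m * (k * c)               ≡⟨ solve (m ∷ k ∷ c ∷ []) ⟩
  k * (m * c) + k * c           ≡⟨ cong (λ x → k * x + k * c) mc≡[1+m]a ⟩
  k * (suc m * a) + k * c       ≤⟨ +-monoʳ-≤ (k * (suc m * a)) (*-monoˡ-≤ c k≤1+m) ⟩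
  k * (suc m * a) + suc m * c   ≡⟨ solve (m ∷ k ∷ a ∷ c ∷ []) ⟩
  suc m * (k * a + c)           ∎)
  where open ≤-Reasoning

[1+m*2]/2≡m : ∀ m → suc (m * 2) / 2 ≡ m
[1+m*2]/2≡m zero = refl
[1+m*2]/2≡m (suc m) =
  trans (m/n≡1+[m∸n]/n {suc (suc (suc (m * 2)))} (s≤s (s≤s z≤n))) (cong suc ([1+m*2]/2≡m m))

parity : ∀ m → ∃[ t ] (m ≡ t * 2 ⊎ m ≡ suc (t * 2))
parity zero = 0 , inj₁ refl
parity (suc m) with parity m
... | t , inj₁ refl = t , inj₂ refl
... | t , inj₂ refl = suc t , inj₁ refl

record MiddleLevel (n : ℕ) : Set where
  field
    t : ℕ
    below : t * 2 < n
    above : n ≤ suc t * 2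
    pascal : centralBinom (suc n) ≡ n C t + centralBinom n
    close : ∀ k → k ≤ suc t → k * centralBinom n ≤ k * (n C t) + centralBinom n

middle-odd : ∀ t → MiddleLevel (suc (t * 2))
middle-odd t = record
  { t = t
  ; below = ≤-refl
  ; above = n≤1+n _
  ; pascal = begin
      centralBinom (suc n)   ≡⟨ cong (suc n C_) (m*n/n≡m (suc t) 2) ⟩
      suc n C suc t          ≡⟨ *-cancelˡ-≡ _ _ (suc t) doubled ⟩
      low + low              ≡⟨ cong (low +_) central≡low ⟨
      low + centralBinom n   ∎
  ; close = λ k _ → subst (λ x → k * x ≤ k * low + x) (sym central≡low) (m≤m+n (k * low) low)
  }
  where
  open ≡-Reasoning
  n low : ℕ
  n = suc (t * 2)
  low = n C t

  central≡low : centralBinom n ≡ low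
  central≡low = cong (n C_) ([1+m*2]/2≡m t)

  doubled : suc t * (suc n C suc t) ≡ suc t * (low + low)
  doubled = begin
    suc t * (suc n C suc t)     ≡⟨ absorption n t ⟩
    suc t * 2 * low             ≡⟨ *-assoc (suc t) 2 low ⟩
    suc t * (low + (low + 0))   ≡⟨ cong (λ x → suc t * (low + x)) (+-identityʳ low) ⟩
    suc t * (low + low)         ∎

middle-even : ∀ t → MiddleLevel (suc t * 2)
middle-even t = record
  { t = t
  ; below = n≤1+n _
  ; above = ≤-refl
  ; pascal = begin
      centralBinom (suc n)   ≡⟨ cong (suc n C_) ([1+m*2]/2≡m (suc t)) ⟩
      suc n C suc t          ≡⟨ nCk+nC[k+1]≡[n+1]C[k+1] n t ⟨
      low + mid              ≡⟨ cong (low +_) central≡mid ⟨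
      low + centralBinom n   ∎
  ; close = λ k k≤1+t → subst (λ x → k * x ≤ k * low + x) (sym central≡mid)
                              (ratio-bound (suc t) k [1+t]mid≡[2+t]low (m≤n⇒m≤1+n k≤1+t))
  }
  where
  open ≡-Reasoning
  n low mid : ℕ
  n = suc t * 2
  low = n C t
  mid = n C suc t

  central≡mid : centralBinom n ≡ mid
  central≡mid = cong (n C_) (m*n/n≡m (suc t) 2)

  1+n≡[1+t]+[2+t] : suc (suc t * 2) ≡ suc t + suc (suc t)
  1+n≡[1+t]+[2+t] = solve (t ∷ [])

  [1+t]mid≡[2+t]low : suc t * mid ≡ suc (suc t) * low
  [1+t]mid≡[2+t]low = +-cancelˡ-≡ (suc t * low) _ _ (begin
    suc t * low + suc t * mid         ≡⟨ *-distribˡ-+ (suc t) low mid ⟨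
    suc t * (low + mid)               ≡⟨ cong (suc t *_) (nCk+nC[k+1]≡[n+1]C[k+1] n t) ⟩
    suc t * (suc n C suc t)           ≡⟨ absorption n t ⟩
    suc n * low                       ≡⟨ cong (_* low) 1+n≡[1+t]+[2+t] ⟩
    (suc t + suc (suc t)) * low       ≡⟨ *-distribʳ-+ low (suc t) (suc (suc t)) ⟩
    suc t * low + suc (suc t) * low   ∎)

middleLevel : ∀ m → MiddleLevel (suc m)
middleLevel m with parity m
... | t , inj₁ refl = middle-odd t
... | t , inj₂ refl = middle-even t

excess-estimate : ∀ k P V la a c C → C ≡ a + c →
  P + a ≤ V → V ≤ P + la → 2 * k * la ≤ 2 * k * c + c → k * c ≤ k * a + c →
  (k * (2 * V) ≤ k * (2 * P + C) + 2 * C) × (k * (2 * P + C) ≤ k * (2 * V) + 2 * C)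
excess-estimate k P V la a c _ refl P+a≤V V≤P+la la-close c-close = V-not-too-large , V-not-too-small
  where
  open ≤-Reasoning
  c≤2[a+c] : c ≤ 2 * (a + c)
  c≤2[a+c] = ≤-trans (m≤n+m c a) (m≤m+n (a + c) _)

  V-not-too-large : k * (2 * V) ≤ k * (2 * P + (a + c)) + 2 * (a + c)
  V-not-too-large = begin
    k * (2 * V)                           ≤⟨ *-monoʳ-≤ k (*-monoʳ-≤ 2 V≤P+la) ⟩
    k * (2 * (P + la))                    ≡⟨ solve (k ∷ P ∷ la ∷ []) ⟩
    k * (2 * P) + 2 * k * la              ≤⟨ +-monoʳ-≤ (k * (2 * P)) la-close ⟩
    k * (2 * P) + (2 * k * c + c)         ≡⟨ solve (k ∷ P ∷ c ∷ []) ⟩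
    k * (2 * P) + k * c + (k * c + c)     ≤⟨ +-monoʳ-≤ (k * (2 * P) + k * c) (+-monoˡ-≤ c c-close) ⟩
    k * (2 * P) + k * c + (k * a + c + c) ≡⟨ solve (k ∷ P ∷ a ∷ c ∷ []) ⟩
    k * (2 * P + (a + c)) + 2 * c         ≤⟨ +-monoʳ-≤ (k * (2 * P + (a + c))) (*-monoʳ-≤ 2 (m≤n+m c a)) ⟩
    k * (2 * P + (a + c)) + 2 * (a + c)   ∎

  V-not-too-small : k * (2 * P + (a + c)) ≤ k * (2 * V) + 2 * (a + c)
  V-not-too-small = begin
    k * (2 * P + (a + c))                 ≡⟨ solve (k ∷ P ∷ a ∷ c ∷ []) ⟩
    k * (2 * P) + k * a + k * c           ≤⟨ +-monoʳ-≤ (k * (2 * P) + k * a) c-close ⟩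
    k * (2 * P) + k * a + (k * a + c)     ≡⟨ solve (k ∷ P ∷ a ∷ c ∷ []) ⟩
    k * (2 * (P + a)) + c                 ≤⟨ +-mono-≤ (*-monoʳ-≤ k (*-monoʳ-≤ 2 P+a≤V)) c≤2[a+c] ⟩
    k * (2 * V) + 2 * (a + c)             ∎

-- Opened only after the ring-solver calls above, whose variable lists need an unambiguous List._∷_.
open import Data.Vec using ([]; _∷_)
open import Data.List.Relation.Unary.All using ([])
open import Data.List.Relation.Unary.AllPairs using ([]; _∷_)

module _ {A : Set} where

  lookup-injective : ∀ {xs : List A} → Unique xs → Injective _≡_ _≡_ (lookup xs)
  lookup-injective {_ ∷ _} _ {zero} {zero} _ = refl
  lookup-injective {_ ∷ _} (x∉xs ∷ _) {zero} {suc j} eq =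
    contradiction eq (All.lookup x∉xs (∈-lookup j))
  lookup-injective {_ ∷ _} (x∉xs ∷ _) {suc i} {zero} eq =
    contradiction (sym eq) (All.lookup x∉xs (∈-lookup i))
  lookup-injective {_ ∷ _} (_ ∷ xs!) {suc i} {suc j} eq = cong suc (lookup-injective xs! eq)

  unique-⊆⇒length≤ : ∀ {xs ys : List A} → Unique xs → (∀ {x} → x ∈ xs → x ∈ ys) →
                      length xs ≤ length ys
  unique-⊆⇒length≤ {xs} {ys} xs! xs⊆ys = injective⇒≤ position-injective
    where
    position : Fin (length xs) → Fin (length ys)
    position i = Any.index (xs⊆ys (∈-lookup i))

    position-injective : Injective _≡_ _≡_ position
    position-injective {i} {j} eq = lookup-injective xs! (begin
      lookup xs i                        ≡⟨ lookup-index (xs⊆ys (∈-lookup i)) ⟩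
      lookup ys (position i)             ≡⟨ cong (lookup ys) eq ⟩
      lookup ys (position j)             ≡⟨ sym (lookup-index (xs⊆ys (∈-lookup j))) ⟩
      lookup xs j                        ∎)
      where open ≡-Reasoning

  module _ {p q} {P : Pred A p} {Q : Pred A q} (P? : Decidable P) (Q? : Decidable Q) where

    length-filter-∪-∩ : ∀ xs →
      length (filter P? xs) + length (filter Q? xs) ≡
      length (filter (P? ∪? Q?) xs) + length (filter (P? ∩? Q?) xs)
    length-filter-∪-∩ [] = refl
    length-filter-∪-∩ (x ∷ xs) with ih ← length-filter-∪-∩ xs | does (P? x) | does (Q? x)
    ... | true  | true  = cong suc (trans (+-suc _ _) (trans (cong suc ih) (sym (+-suc _ _))))
    ... | true  | false = cong suc ih
    ... | false | true  = trans (+-suc _ _) (cong suc ih)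
    ... | false | false = ih

  length-filter-map : ∀ {B : Set} {p} {P : Pred B p} (P? : Decidable P) (f : A → B) xs →
    length (filter P? (map f xs)) ≡ length (filter (λ x → P? (f x)) xs)
  length-filter-map P? f [] = refl
  length-filter-map P? f (x ∷ xs) with does (P? (f x))
  ... | true  = cong suc (length-filter-map P? f xs)
  ... | false = length-filter-map P? f xs

subsets : (n : ℕ) → List (Subset n)
subsets zero = [ [] ]
subsets (suc n) = map (inside ∷_) (subsets n) ++ map (outside ∷_) (subsets n)

∈-subsets : ∀ {n} (s : Subset n) → s ∈ subsets n
∈-subsets [] = here refl
∈-subsets (inside ∷ s) = ∈-++⁺ˡ (∈-map⁺ (inside ∷_) (∈-subsets s))
∈-subsets (outside ∷ s) = ∈-++⁺ʳ _ (∈-map⁺ (outside ∷_) (∈-subsets s))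

subsets-unique : ∀ n → Unique (subsets n)
subsets-unique zero = [] ∷ []
subsets-unique (suc n) =
  Unique.++⁺ (Unique.map⁺ Vec.∷-injectiveʳ (subsets-unique n))
             (Unique.map⁺ Vec.∷-injectiveʳ (subsets-unique n))
             different-heads
  where
  different-heads : ∀ {s} → ¬ (s ∈ map (inside ∷_) (subsets n) × s ∈ map (outside ∷_) (subsets n))
  different-heads (s∈ins , s∈outs) with ∈-map⁻ (inside ∷_) s∈ins | ∈-map⁻ (outside ∷_) s∈outs
  ... | _ , _ , refl | _ , _ , ()

length-subsets : ∀ n → length (subsets n) ≡ 2 ^ n
length-subsets zero = refl
length-subsets (suc n) = begin
  length (map (inside ∷_) (subsets n) ++ map (outside ∷_) (subsets n))
    ≡⟨ length-++ (map (inside ∷_) (subsets n)) ⟩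
  length (map (inside ∷_) (subsets n)) + length (map (outside ∷_) (subsets n))
    ≡⟨ cong₂ _+_ (length-map _ (subsets n)) (length-map _ (subsets n)) ⟩
  length (subsets n) + length (subsets n)
    ≡⟨ cong₂ _+_ (length-subsets n) (trans (length-subsets n) (sym (+-identityʳ _))) ⟩
  2 ^ suc n ∎
  where open ≡-Reasoning

length-level : ∀ n t → length (filter (λ s → ∣ s ∣ ≟ t) (subsets n)) ≡ n C t
length-level zero zero = refl
length-level zero (suc t) = refl
length-level (suc n) t = begin
  length (filter (λ s → ∣ s ∣ ≟ t) (map (inside ∷_) S ++ map (outside ∷_) S))
    ≡⟨ cong length (filter-++ _ (map (inside ∷_) S) _) ⟩
  length (filter (λ s → ∣ s ∣ ≟ t) (map (inside ∷_) S) ++ filter (λ s → ∣ s ∣ ≟ t) (map (outside ∷_) S))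
    ≡⟨ length-++ (filter _ (map (inside ∷_) S)) ⟩
  length (filter (λ s → ∣ s ∣ ≟ t) (map (inside ∷_) S)) + length (filter (λ s → ∣ s ∣ ≟ t) (map (outside ∷_) S))
    ≡⟨ cong₂ _+_ (length-filter-map _ (inside ∷_) S) (length-filter-map _ (outside ∷_) S) ⟩
  length (filter (λ s → suc ∣ s ∣ ≟ t) S) + length (filter (λ s → ∣ s ∣ ≟ t) S)
    ≡⟨ pascal t ⟩
  suc n C t ∎
  where
  open ≡-Reasoning
  S : List (Subset n)
  S = subsets n

  pascal : ∀ t → length (filter (λ s → suc ∣ s ∣ ≟ t) S) + length (filter (λ s → ∣ s ∣ ≟ t) S) ≡ suc n C t
  pascal zero = cong₂ _+_ (cong length (filter-none (λ s → suc ∣ s ∣ ≟ 0) (All.universal (λ _ ()) S)))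
                         (length-level n zero)
  pascal (suc t) = begin
    length (filter (λ s → suc ∣ s ∣ ≟ suc t) S) + length (filter (λ s → ∣ s ∣ ≟ suc t) S)
      ≡⟨ cong₂ _+_ (cong length (filter-≐ _ _ (suc-injective , cong suc) S)) (length-level n (suc t)) ⟩
    length (filter (λ s → ∣ s ∣ ≟ t) S) + n C suc t
      ≡⟨ cong (_+ n C suc t) (length-level n t) ⟩
    n C t + n C suc t
      ≡⟨ nCk+nC[k+1]≡[n+1]C[k+1] n t ⟩
    suc n C suc t ∎

∁-involutive : ∀ {n} (p : Subset n) → ∁ (∁ p) ≡ p
∁-involutive {n} = BooleanAlgebraProperties.¬-involutive (∪-∩-booleanAlgebra n)

∁-injective : ∀ {n} {p q : Subset n} → ∁ p ≡ ∁ q → p ≡ q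
∁-injective {p = p} {q} eq = trans (sym (∁-involutive p)) (trans (cong ∁ eq) (∁-involutive q))

∣p∣+∣∁p∣≡n : ∀ {n} (p : Subset n) → ∣ p ∣ + ∣ ∁ p ∣ ≡ n
∣p∣+∣∁p∣≡n p = trans (cong (∣ p ∣ +_) (∣∁p∣≡n∸∣p∣ p)) (m+[n∸m]≡n (∣p∣≤n p))

⊆⇒∁-disjoint : ∀ {n} {p q : Subset n} → p ⊆ q → Disjoint (∁ q) p
⊆⇒∁-disjoint p⊆q = Empty-unique λ (x , x∈∁q∩p) →
  let x∈∁q , x∈p = x∈p∩q⁻ _ _ x∈∁q∩p in x∈∁p⇒x∉p x∈∁q (p⊆q x∈p)

disjoint⇒⊆∁ : ∀ {n} {p q : Subset n} → Disjoint p q → q ⊆ ∁ p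
disjoint⇒⊆∁ {p = p} {q} p∩q≡⊥ {x} x∈q =
  x∉p⇒x∈∁p λ x∈p → ∉⊥ (subst (x Subset.∈_) p∩q≡⊥ (x∈p∩q⁺ (x∈p , x∈q)))

disjoint⇒∣p∣+∣q∣≤n : ∀ {n} {p q : Subset n} → Disjoint p q → ∣ p ∣ + ∣ q ∣ ≤ n
disjoint⇒∣p∣+∣q∣≤n {p = p} disj =
  ≤-trans (+-monoʳ-≤ ∣ p ∣ (p⊆q⇒∣p∣≤∣q∣ (disjoint⇒⊆∁ disj))) (≤-reflexive (∣p∣+∣∁p∣≡n p))

disjoint⇒≡∁ : ∀ {n} {p q : Subset n} → Disjoint p q → n ≤ ∣ p ∣ + ∣ q ∣ → q ≡ ∁ p
disjoint⇒≡∁ {n} {p} {q} disj covering = ⊆-antisym (disjoint⇒⊆∁ disj) ∁p⊆q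
  where
  ∁p⊆q : ∁ p ⊆ q
  ∁p⊆q {x} x∈∁p with x Subsetₚ.∈? q
  ... | yes x∈q = x∈q
  ... | no x∉q = contradiction covering (<⇒≱ (<-≤-trans
    (+-monoʳ-< ∣ p ∣ (p⊂q⇒∣p∣<∣q∣ (disjoint⇒⊆∁ disj , x , x∈∁p , x∉q)))
    (≤-reflexive (∣p∣+∣∁p∣≡n p))))

glue : ∀ {n} → List (Subset n) → List (Subset n) → List (Subset (suc n))
glue X Y = map (inside ∷_) X ++ map (λ s → outside ∷ ∁ s) Y

length-glue : ∀ {n} (X Y : List (Subset n)) → length (glue X Y) ≡ length X + length Y
length-glue X Y = trans (length-++ (map (inside ∷_) X)) (cong₂ _+_ (length-map _ X) (length-map _ Y))

∈-glue⁺ˡ : ∀ {n} {X Y : List (Subset n)} {s} → s ∈ X → (inside ∷ s) ∈ glue X Y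
∈-glue⁺ˡ s∈X = ∈-++⁺ˡ (∈-map⁺ (inside ∷_) s∈X)

∈-glue⁺ʳ : ∀ {n} {X Y : List (Subset n)} {s} → s ∈ Y → (outside ∷ ∁ s) ∈ glue X Y
∈-glue⁺ʳ {X = X} s∈Y = ∈-++⁺ʳ (map (inside ∷_) X) (∈-map⁺ (λ s → outside ∷ ∁ s) s∈Y)

glue-elim : ∀ {n} {X Y : List (Subset n)} (P : Subset (suc n) → Set) →
  (∀ {s} → s ∈ X → P (inside ∷ s)) → (∀ {s} → s ∈ Y → P (outside ∷ ∁ s)) →
  ∀ {x} → x ∈ glue X Y → P x
glue-elim {X = X} P onX onY x∈glue with ∈-++⁻ (map (inside ∷_) X) x∈glue
... | inj₁ x∈X′ with _ , s∈X , refl ← ∈-map⁻ (inside ∷_) x∈X′ = onX s∈X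
... | inj₂ x∈Y′ with _ , s∈Y , refl ← ∈-map⁻ (λ s → outside ∷ ∁ s) x∈Y′ = onY s∈Y

glue-unique : ∀ {n} {X Y : List (Subset n)} → Unique X → Unique Y → Unique (glue X Y)
glue-unique X! Y! = Unique.++⁺ (Unique.map⁺ Vec.∷-injectiveʳ X!)
                               (Unique.map⁺ (∁-injective ∘ Vec.∷-injectiveʳ) Y!)
                               different-heads
  where
  different-heads : ∀ {x} → ¬ (x ∈ map (inside ∷_) _ × x ∈ map (λ s → outside ∷ ∁ s) _)
  different-heads (x∈X′ , x∈Y′) with ∈-map⁻ (inside ∷_) x∈X′ | ∈-map⁻ (λ s → outside ∷ ∁ s) x∈Y′
  ... | _ , _ , refl | _ , _ , ()

Both : ∀ {n} → Family (suc n) → Family n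
Both F s = F (inside ∷ s) × F (outside ∷ ∁ s)

ContainsPGA-mono : ∀ G {n} {F F′ : Family n} → (∀ {s} → F s → F′ s) → ContainsPGA G F → ContainsPGA G F′
ContainsPGA-mono G F⊆F′ (β , β-injective , β∈F , β-monotone) = β , β-injective , (F⊆F′ ∘ β∈F) , β-monotone

ContainsPGA-Both⇒ContainsG : ∀ G {n} {F : Family (suc n)} → ContainsPGA G (Both F) → ContainsG G F
ContainsPGA-Both⇒ContainsG G {n} {F} (β , β-injective , β∈Both , β-monotone) = f , f-injective , f∈F , f-disjoint
  where
  f : V G → Subset (suc n)
  f (inj₁ i) = outside ∷ ∁ (β (inj₁ i))
  f (inj₂ j) = inside ∷ β (inj₂ j)

  f-injective : Injective _≡_ _≡_ f
  f-injective {inj₁ _} {inj₁ _} eq = β-injective (∁-injective (Vec.∷-injectiveʳ eq))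
  f-injective {inj₁ _} {inj₂ _} ()
  f-injective {inj₂ _} {inj₁ _} ()
  f-injective {inj₂ _} {inj₂ _} eq = β-injective (Vec.∷-injectiveʳ eq)

  f∈F : ∀ v → F (f v)
  f∈F (inj₁ i) = proj₂ (β∈Both (inj₁ i))
  f∈F (inj₂ j) = proj₁ (β∈Both (inj₂ j))

  f-disjoint : ∀ i j → E G i j ≡ true → Disjoint (f (inj₁ i)) (f (inj₂ j))
  f-disjoint i j ij∈E = cong (outside ∷_) (⊆⇒∁-disjoint (β-monotone i j ij∈E))

vex-upper : ∀ G n {la v} → IsLa G n la → IsVex G (suc n) v → v ≤ 2 ^ n + la
vex-upper G n {la} (La-bound , _) (_ , L , L! , L-G-free , refl) = begin
  length L                                            ≤⟨ unique-⊆⇒length≤ L! L⊆glue ⟩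
  length (glue X Y)                                   ≡⟨ length-glue X Y ⟩
  length X + length Y                                 ≡⟨ length-filter-∪-∩ X? Y? (subsets n) ⟩
  length (filter (X? ∪? Y?) (subsets n)) + length Both-list
    ≤⟨ +-mono-≤ (≤-trans (length-filter _ (subsets n)) (≤-reflexive (length-subsets n)))
                (La-bound Both-list (Unique.filter⁺ _ (subsets-unique n)) Both-list-PGA-free) ⟩
  2 ^ n + la                                          ∎
  where
  open ≤-Reasoning
  open DecMembership (Vec.≡-dec _≟ᵇ_) using (_∈?_)

  X? : Decidable (λ s → (inside ∷ s) ∈ L)
  X? s = (inside ∷ s) ∈? L
  Y? : Decidable (λ s → (outside ∷ ∁ s) ∈ L)
  Y? s = (outside ∷ ∁ s) ∈? L

  X Y Both-list : List (Subset n)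
  X = filter X? (subsets n)
  Y = filter Y? (subsets n)
  Both-list = filter (X? ∩? Y?) (subsets n)

  L⊆glue : ∀ {x} → x ∈ L → x ∈ glue X Y
  L⊆glue {inside ∷ s} x∈L = ∈-glue⁺ˡ (∈-filter⁺ X? (∈-subsets s) x∈L)
  L⊆glue {outside ∷ s} x∈L = subst (λ s′ → (outside ∷ s′) ∈ glue X Y) (∁-involutive s)
    (∈-glue⁺ʳ (∈-filter⁺ Y? (∈-subsets (∁ s)) (subst (λ s′ → (outside ∷ s′) ∈ L) (sym (∁-involutive s)) x∈L)))

  Both-list-PGA-free : PGA-free G (_∈ Both-list)
  Both-list-PGA-free copy = L-G-free (ContainsPGA-Both⇒ContainsG G {F = _∈ L}
    (ContainsPGA-mono G (λ {s} → proj₂ ∘ ∈-filter⁻ (X? ∩? Y?) {s} {subsets n}) copy))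

complementary⇒G-free : ∀ G {n} {F : Family n} → ¬ IsMatching G →
  (∀ {x y} → F x → F y → Disjoint x y → y ≡ ∁ x) → G-free G F
complementary⇒G-free G not-matching complementary (f , f-injective , f∈F , f-disjoint) =
  not-matching (one-neighbour-in-B , one-neighbour-in-A)
  where
  neighbour≡∁ : ∀ i j → E G i j ≡ true → f (inj₂ j) ≡ ∁ (f (inj₁ i))
  neighbour≡∁ i j ij∈E = complementary (f∈F (inj₁ i)) (f∈F (inj₂ j)) (f-disjoint i j ij∈E)

  one-neighbour-in-B : ∀ i j j′ → E G i j ≡ true → E G i j′ ≡ true → j ≡ j′
  one-neighbour-in-B i j j′ ij∈E ij′∈E =
    inj₂-injective (f-injective (trans (neighbour≡∁ i j ij∈E) (sym (neighbour≡∁ i j′ ij′∈E))))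

  one-neighbour-in-A : ∀ i i′ j → E G i j ≡ true → E G i′ j ≡ true → i ≡ i′
  one-neighbour-in-A i i′ j ij∈E i′j∈E =
    inj₁-injective (f-injective (∁-injective (trans (sym (neighbour≡∁ i j ij∈E)) (neighbour≡∁ i′ j i′j∈E))))

Extremal : ∀ {n} → Family (suc n)
Extremal {n} (inside ∷ s) = n ≤ suc ∣ s ∣ * 2
Extremal {n} (outside ∷ s) = n < ∣ s ∣ * 2

Extremal? : ∀ {n} → Decidable (Extremal {n})
Extremal? {n} (inside ∷ s) = n ≤? suc ∣ s ∣ * 2
Extremal? {n} (outside ∷ s) = n <? ∣ s ∣ * 2

m*2≡m+m : ∀ m → m * 2 ≡ m + m
m*2≡m+m m = trans (*-comm m 2) (cong (m +_) (+-identityʳ m))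

small⇒∁-large : ∀ {n} (p : Subset n) → ∣ p ∣ * 2 < n → n < ∣ ∁ p ∣ * 2
small⇒∁-large {n} p small = +-cancelˡ-< n n (∣ ∁ p ∣ * 2) (begin-strict
  n + n                        ≡⟨ m*2≡m+m n ⟨
  n * 2                        ≡⟨ cong (_* 2) (∣p∣+∣∁p∣≡n p) ⟨
  (∣ p ∣ + ∣ ∁ p ∣) * 2        ≡⟨ *-distribʳ-+ 2 ∣ p ∣ ∣ ∁ p ∣ ⟩
  ∣ p ∣ * 2 + ∣ ∁ p ∣ * 2      <⟨ +-monoˡ-< (∣ ∁ p ∣ * 2) small ⟩
  n + ∣ ∁ p ∣ * 2              ∎)
  where open ≤-Reasoning

Extremal-disjoint⇒∁ : ∀ {n} {x y : Subset (suc n)} → Extremal x → Extremal y → Disjoint x y → y ≡ ∁ x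
Extremal-disjoint⇒∁ {x = inside ∷ _} {inside ∷ _} _ _ ()
Extremal-disjoint⇒∁ {n} {inside ∷ s} {outside ∷ s′} n≤ n< disj = disjoint⇒≡∁ disj (*-cancelʳ-< 2 n _ (begin-strict
  n * 2                        ≡⟨ m*2≡m+m n ⟩
  n + n                        <⟨ +-mono-≤-< n≤ n< ⟩
  suc ∣ s ∣ * 2 + ∣ s′ ∣ * 2   ≡⟨ *-distribʳ-+ 2 (suc ∣ s ∣) ∣ s′ ∣ ⟨
  (suc ∣ s ∣ + ∣ s′ ∣) * 2     ∎))
  where open ≤-Reasoning
Extremal-disjoint⇒∁ {x = outside ∷ s} {inside ∷ s′} s-ext s′-ext disj =
  trans (sym (∁-involutive (inside ∷ s′)))
        (cong ∁ (sym (Extremal-disjoint⇒∁ s′-ext s-ext (trans (∩-comm (inside ∷ s′) (outside ∷ s)) disj))))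
Extremal-disjoint⇒∁ {n} {outside ∷ s} {outside ∷ s′} n< n<′ disj = contradiction (begin-strict
  n + n                        <⟨ +-mono-< n< n<′ ⟩
  ∣ s ∣ * 2 + ∣ s′ ∣ * 2       ≡⟨ *-distribʳ-+ 2 ∣ s ∣ ∣ s′ ∣ ⟨
  (∣ s ∣ + ∣ s′ ∣) * 2         ≤⟨ *-monoˡ-≤ 2 (disjoint⇒∣p∣+∣q∣≤n (Vec.∷-injectiveʳ disj)) ⟩
  n * 2                        ≡⟨ m*2≡m+m n ⟩
  n + n                        ∎) (<-irrefl refl)
  where open ≤-Reasoning

vex-lower : ∀ G → ¬ IsMatching G → ∀ n t {v} → t * 2 < n → n ≤ suc t * 2 → IsVex G (suc n) v →
  2 ^ n + n C t ≤ v
vex-lower G not-matching n t {v} t*2<n n≤ (vex-bound , _) = begin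
  2 ^ n + n C t
    ≡⟨ cong₂ _+_ all-counted (length-level n t) ⟨
  length (filter (X? ∪? Y?) (subsets n)) + length (filter level? (subsets n))
    ≤⟨ +-monoʳ-≤ _ (length-mono-≤ (filter⁺ level? (X? ∩? Y?) level⇒both (⊆-refl {x = subsets n}))) ⟩
  length (filter (X? ∪? Y?) (subsets n)) + length (filter (X? ∩? Y?) (subsets n))
    ≡⟨ length-filter-∪-∩ X? Y? (subsets n) ⟨
  length X + length Y
    ≡⟨ length-glue X Y ⟨
  length (glue X Y)
    ≤⟨ vex-bound (glue X Y) (glue-unique (Unique.filter⁺ X? (subsets-unique n)) (Unique.filter⁺ Y? (subsets-unique n)))
                 glue-G-free ⟩
  v ∎
  where
  open ≤-Reasoning
  X? : Decidable (λ s → Extremal (inside ∷ s))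
  X? s = Extremal? (inside ∷ s)
  Y? : Decidable (λ s → Extremal (outside ∷ ∁ s))
  Y? s = Extremal? (outside ∷ ∁ s)
  level? : Decidable (λ (s : Subset n) → ∣ s ∣ ≡ t)
  level? s = ∣ s ∣ ≟ t

  X Y : List (Subset n)
  X = filter X? (subsets n)
  Y = filter Y? (subsets n)

  glue-G-free : G-free G (_∈ glue X Y)
  glue-G-free = complementary⇒G-free G not-matching λ x∈ y∈ →
    Extremal-disjoint⇒∁ (glue-Extremal x∈) (glue-Extremal y∈)
    where
    glue-Extremal : ∀ {x} → x ∈ glue X Y → Extremal x
    glue-Extremal = glue-elim {X = X} {Y} Extremal (proj₂ ∘ ∈-filter⁻ X? {xs = subsets n})
                                                      (proj₂ ∘ ∈-filter⁻ Y? {xs = subsets n})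

  Extremal-total : ∀ s → Extremal (inside ∷ s) ⊎ Extremal (outside ∷ ∁ s)
  Extremal-total s with n <? ∣ ∁ s ∣ * 2
  ... | yes n< = inj₂ n<
  ... | no n≮ = inj₁ (≤-trans (≮⇒≥ (n≮ ∘ small⇒∁-large s)) (*-monoˡ-≤ 2 (n≤1+n ∣ s ∣)))

  all-counted : length (filter (X? ∪? Y?) (subsets n)) ≡ 2 ^ n
  all-counted = trans (cong length (filter-all (X? ∪? Y?) (All.universal Extremal-total (subsets n))))
                      (length-subsets n)

  level⇒both : ∀ {s s′} → s ≡ s′ → ∣ s ∣ ≡ t → Extremal (inside ∷ s′) × Extremal (outside ∷ ∁ s′)
  level⇒both {s} refl refl = n≤ , small⇒∁-large s t*2<n

corollary8 : (G : BipGraph) → ¬ IsMatching G → IsE G 1 →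
    (La : ℕ → ℕ) → (∀ n → IsLa G n (La n)) → AsympCentral La →
    (vex : ℕ → ℕ) → (∀ n → IsVex G n (vex n)) → AsympVex vex
corollary8 G not-matching _ La isLa La≈central vex isVex k 1≤k = suc (suc (N₀ + k * 2)) , vex≈
  where
  La-close : ∃[ N ] ∀ n → N ≤ n →
    (2 * k * La n ≤ 2 * k * centralBinom n + centralBinom n) ×
    (2 * k * centralBinom n ≤ 2 * k * La n + centralBinom n)
  La-close = La≈central (2 * k) (≤-trans 1≤k (m≤m+n k _))

  N₀ : ℕ
  N₀ = proj₁ La-close

  vex≈ : ∀ n → suc (suc (N₀ + k * 2)) ≤ n →
    (k * (2 * vex n) ≤ k * (2 ^ n + centralBinom n) + 2 * centralBinom n) ×
    (k * (2 ^ n + centralBinom n) ≤ k * (2 * vex n) + 2 * centralBinom n)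
  vex≈ (suc (suc m)) (s≤s (s≤s N₀+2k≤m)) =
    excess-estimate k (2 ^ n) (vex (suc n)) (La n) (n C t) (centralBinom n) _ pascal
      (vex-lower G not-matching n t below above (isVex (suc n)))
      (vex-upper G n (isLa n) (isVex (suc n)))
      (proj₁ (proj₂ La-close n (≤-trans (m≤m+n N₀ _) (m≤n⇒m≤1+n N₀+2k≤m))))
      (close k (*-cancelʳ-≤ k (suc t) 2 (≤-trans (m≤n+m (k * 2) N₀) (≤-trans (m≤n⇒m≤1+n N₀+2k≤m) above))))
    where
    n : ℕ
    n = suc m
    open MiddleLevel (middleLevel m)
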